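{- Let $G=K_n \vee \overline{K_m}$, where the vertices of $K_n$ are $v_1,\ldots,v_n$, let $f: V(K_n) \to \{1,2,\ldots\}$ satisfy $f(v_1) \le f(v_2) \le \ldots \le f(v_n)$, and let $f^{(m)}$ be the extension of $f$ to $G$ with $f^{(m)}(v)=n$ for each vertex $v$ of $\overline{K_m}$. If $m < \psi(\vec{x}(f))$, then $G$ is $f^{(m)}$-paintable.
   Context: The join $G \vee H$ is obtained from the disjoint union of $G$ and $H$ by adding all edges between $V(G)$ and $V(H)$; $\overline{K_m}$ is the edgeless graph on $m$ vertices. $\vec{x}(f)=(x_1,\ldots,x_n)$ with $x_i=f(v_i)-i$. For $\vec{x}=(x_1,\ldots,x_n)$, an $\vec{x}$-dominated lattice path ending at $(a,b)$ is a lattice path from $(0,0)$ to $(a,b)$ with unit steps right and up such that every vertex $(i,j)$ on it satisfies $i \le x_{j+1}$; $\psi(\vec{x})$ is the number of such paths ending at $(x_n,n)$. $f^{(m)}$-paintable means Painter has a winning strategy in the painting (online list colouring) game where each vertex $v$ starts with $f^{(m)}(v)$ tokens. -}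

module Defs where

open import Data.Nat using (ℕ; zero; suc; _≤_; _<?_; _∸_; NonZero)
open import Data.Integer as ℤ using (ℤ; +_; -[1+_])
open import Data.Fin using (Fin; toℕ; fromℕ; fromℕ<)
open import Data.Sum using (_⊎_; inj₁; inj₂)
open import Data.Bool using (Bool; true; false; T; _∧_; not; if_then_else_)
open import Data.List using (List; []; _∷_; map; _++_)
open import Data.Product using (Σ; ∃; _×_; _,_)
open import Data.Unit using (⊤)
open import Data.Empty using (⊥)
open import Relation.Nullary using (¬_; yes; no)
open import Relation.Nullary.Decidable using (⌊_⌋)
open import Relation.Binary.PropositionalEquality using (_≢_)

-- State: U = set of uncoloured vertices, f = number of remaining tokens.
-- Painter wins from (U , f) iff every uncoloured vertex still has a token,
-- and for every nonempty set M ⊆ U chosen by Lister (each marked vertex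
-- spends one token), Painter can choose an independent I ⊆ M (coloured and
-- removed) such that Painter wins from the resulting state.
-- (If U is empty, no nonempty M exists, so Painter has won.)

data Paintable {V : Set} (E : V → V → Set) : (V → Bool) → (V → ℕ) → Set where
  step : ∀ {U f} →
    (∀ v → T (U v) → 1 ≤ f v) →
    (∀ (M : V → Bool) → (∀ v → T (M v) → T (U v)) → (∃ λ v → T (M v)) →
      Σ (V → Bool) λ I →
        (∀ v → T (I v) → T (M v)) ×
        (∀ u v → T (I u) → T (I v) → ¬ E u v) ×
        Paintable E (λ v → U v ∧ not (I v))
                    (λ v → if M v ∧ not (I v) then f v ∸ 1 else f v)) →
    Paintable E U f

IsPaintable : {V : Set} → (V → V → Set) → (V → ℕ) → Set
IsPaintable E f = Paintable E (λ _ → true) f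

-- The join K_n ∨ \overline{K_m}: vertices inj₁ i (i : Fin n) form K_n
-- (inj₁ i is v_{i+1}), vertices inj₂ j form the edgeless part.

JoinV : ℕ → ℕ → Set
JoinV n m = Fin n ⊎ Fin m

JoinE : ∀ {n m} → JoinV n m → JoinV n m → Set
JoinE (inj₁ i) (inj₁ j) = i ≢ j
JoinE (inj₁ _) (inj₂ _) = ⊤
JoinE (inj₂ _) (inj₁ _) = ⊤
JoinE (inj₂ _) (inj₂ _) = ⊥

ext : ∀ {n m} → (Fin n → ℕ) → JoinV n m → ℕ
ext f (inj₁ i) = f i
ext {n} f (inj₂ _) = n

-- x(f): x_i = f(v_i) - i  (index i : Fin n stands for i+1).
xvec : ∀ {n} → (Fin n → ℕ) → Fin n → ℤ
xvec f i = + f i ℤ.- + suc (toℕ i)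

data Step : Set where
  R U : Step

allPaths : ℕ → ℕ → List (List Step)
allPaths zero zero = [] ∷ []
allPaths (suc a) zero = map (R ∷_) (allPaths a zero)
allPaths zero (suc b) = map (U ∷_) (allPaths zero b)
allPaths (suc a) (suc b) = map (R ∷_) (allPaths a (suc b)) ++ map (U ∷_) (allPaths (suc a) b)

allVerts : (ℕ → ℕ → Bool) → ℕ → ℕ → List Step → Bool
allVerts P i j [] = P i j
allVerts P i j (R ∷ s) = P i j ∧ allVerts P (suc i) j s
allVerts P i j (U ∷ s) = P i j ∧ allVerts P i (suc j) s

-- domination condition at vertex (i,j): i ≤ x_{j+1}; vacuous when x_{j+1}
-- does not exist (j ≥ n, i.e. only the top row j = n).
domOK : ∀ {n} → (Fin n → ℤ) → ℕ → ℕ → Bool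
domOK {n} x i j with j <? n
... | yes p = ⌊ + i ℤ.≤? x (fromℕ< p) ⌋
... | no _ = true

countTrue : ∀ {A : Set} → (A → Bool) → List A → ℕ
countTrue p [] = 0
countTrue p (a ∷ as) = if p a then suc (countTrue p as) else countTrue p as

-- ψ(x): number of x-dominated lattice paths from (0,0) to (x_n, n)
-- (0 if x_n < 0, as then there is no such lattice path).
ψ : (n : ℕ) → .{{_ : NonZero n}} → (Fin n → ℤ) → ℕ
ψ (suc k) x with x (fromℕ k)
... | + a = countTrue (allVerts (domOK x) 0 0) (allPaths a (suc k))
... | -[1+ _ ] = 0

-- Let r be the number of uncoloured clique vertices,
-- g₁, …, g_r their token counts in the order v₁, …, vₙ, and call an uncoloured vertex of
-- the independent side tight if it has at most r tokens. Invariant: every uncoloured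
-- independent vertex has at least r tokens, and there are fewer tight vertices than
-- sequences 1 ≤ s₁ < ⋯ < s_r with sᵢ ≤ gᵢ. Initially this holds because recording i + j + 1
-- at each up-step (i, j) of an x(f)-dominated path yields such a sequence for the gᵢ = f(vᵢ).
-- When Lister marks M and v is the first marked uncoloured clique vertex, the number of
-- sequences is at most the number after colouring v plus the number after colouring no
-- clique vertex. So either the marked tight vertices are fewer than the first number, and
-- Painter colours v (afterwards only they can be tight), or the unmarked tight vertices are
-- fewer than the second, and Painter colours the marked independent vertices (afterwards
-- exactly the unmarked ones are tight); the latter move is also taken when no clique vertex
-- is marked. The invariant leaves a token on every uncoloured vertex, and every round
-- decreases the number of uncoloured vertices plus tokens.

module Submission where

open import Defs
open import Data.Nat using (ℕ; _≤_; _<_; NonZero)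
open import Data.Fin using (Fin)
open import Data.Fin as F using ()

open import Algebra.Properties.CommutativeSemigroup using (interchange)
open import Data.Bool.Base using (Bool; true; false; T; _∧_; not; if_then_else_)
open import Data.Bool.Properties using (T-≡; T-∧; ∧-identityʳ; ∧-zeroʳ)
open import Data.Empty using (⊥-elim)
open import Data.Fin.Base using (toℕ; fromℕ; fromℕ<)
open import Data.Fin.Properties using (toℕ-fromℕ<; fromℕ<-toℕ; toℕ<n)
open import Data.Integer.Base as ℤ using (+_; -[1+_])
import Data.Integer.Properties as ℤ
open import Data.List.Base using (List; []; _∷_; map; _++_; length; tabulate; allFin)
open import Data.List.Properties using (length-map; length-tabulate; tabulate-cong; map-tabulate)
open import Data.List.Membership.Propositional using (_∈_)
open import Data.List.Membership.Propositional.Properties using (∈-map⁺; ∈-++⁺ˡ; ∈-++⁺ʳ; ∈-allFin)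
open import Data.List.Relation.Binary.Pointwise as Pointwise using (Pointwise; []; _∷_)
open import Data.List.Relation.Unary.All as All using (All; []; _∷_)
open import Data.List.Relation.Unary.AllPairs using ([]; _∷_)
open import Data.List.Relation.Unary.Any using (here; there)
open import Data.List.Relation.Unary.Unique.Propositional using (Unique)
open import Data.List.Relation.Unary.Unique.Propositional.Properties using (allFin⁺)
open import Data.Nat.Base
  using (zero; suc; _+_; _*_; _∸_; _≤ᵇ_; z≤n; s≤s; z<s; >-nonZero; >-nonZero⁻¹; ≢-nonZero⁻¹)
open import Data.Nat.Induction using (<-wellFounded)
open import Data.Nat.ListAction using (sum)
open import Data.Nat.Properties
open import Data.Product.Base using (∃; Σ; _×_; _,_; proj₁; proj₂)
open import Data.Sum.Base using (_⊎_; inj₁; inj₂; [_,_]′)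
open import Function.Base using (id; _∘_)
open import Function.Bundles using (Equivalence)
open import Induction.WellFounded using (Acc; acc)
open import Relation.Binary.Definitions using (DecidableEquality)
open import Relation.Binary.PropositionalEquality
open import Relation.Nullary using (yes; no; ¬_)
open import Relation.Nullary.Decidable using (⌊_⌋; T?; toWitness)

module _ {A : Set} where

  selectMap : (A → Bool) → (A → ℕ) → List A → List ℕ
  selectMap u g []       = []
  selectMap u g (x ∷ xs) = if u x then g x ∷ selectMap u g xs else selectMap u g xs

  remaining : (A → Bool) → (A → Bool) → A → Bool
  remaining u I x = u x ∧ not (I x)

  spent : (A → Bool) → (A → Bool) → (A → ℕ) → A → ℕ
  spent mk I h x = if mk x ∧ not (I x) then h x ∸ 1 else h x

  none : A → Bool
  none _ = false

  countTrue-cong : ∀ {p q : A → Bool} → (∀ a → p a ≡ q a) → ∀ L → countTrue p L ≡ countTrue q L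
  countTrue-cong p≗q []      = refl
  countTrue-cong {p} {q} p≗q (a ∷ L) rewrite p≗q a with q a
  ... | true  = cong suc (countTrue-cong p≗q L)
  ... | false = countTrue-cong p≗q L

  countTrue-none : ∀ {p : A → Bool} → (∀ a → p a ≡ false) → ∀ L → countTrue p L ≡ 0
  countTrue-none all-false []      = refl
  countTrue-none {p} all-false (a ∷ L) rewrite all-false a = countTrue-none all-false L

  countTrue-≤-length : ∀ (p : A → Bool) L → countTrue p L ≤ length L
  countTrue-≤-length p []      = z≤n
  countTrue-≤-length p (a ∷ L) with p a
  ... | true  = s≤s (countTrue-≤-length p L)
  ... | false = m≤n⇒m≤1+n (countTrue-≤-length p L)

  countTrue-++ : ∀ (p : A → Bool) L₁ L₂ → countTrue p (L₁ ++ L₂) ≡ countTrue p L₁ + countTrue p L₂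
  countTrue-++ p []       L₂ = refl
  countTrue-++ p (a ∷ L₁) L₂ with p a
  ... | true  = cong suc (countTrue-++ p L₁ L₂)
  ... | false = countTrue-++ p L₁ L₂

  countTrue-map : ∀ {B : Set} (p : B → Bool) (g : A → B) L → countTrue p (map g L) ≡ countTrue (λ a → p (g a)) L
  countTrue-map p g []      = refl
  countTrue-map p g (a ∷ L) with p (g a)
  ... | true  = cong suc (countTrue-map p g L)
  ... | false = countTrue-map p g L

  countTrue-mono : ∀ {p q : A → Bool} → (∀ a → T (p a) → T (q a)) → ∀ L → countTrue p L ≤ countTrue q L
  countTrue-mono p⇒q [] = z≤n
  countTrue-mono {p} {q} p⇒q (a ∷ L) with p a in pa | q a in qa
  ... | true  | true  = s≤s (countTrue-mono p⇒q L)
  ... | false | true  = m≤n⇒m≤1+n (countTrue-mono p⇒q L)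
  ... | false | false = countTrue-mono p⇒q L
  ... | true  | false = ⊥-elim (subst T qa (p⇒q a (subst T (sym pa) _)))

  countTrue-mono-< : ∀ {p q : A → Bool} → (∀ a → T (p a) → T (q a)) →
    ∀ {L y} → y ∈ L → ¬ T (p y) → T (q y) → countTrue p L < countTrue q L
  countTrue-mono-< {p} {q} p⇒q {a ∷ L} (here refl) ¬py qy with p a | q a
  ... | true  | _    = ⊥-elim (¬py _)
  ... | false | true = s≤s (countTrue-mono p⇒q L)
  countTrue-mono-< {p} {q} p⇒q {a ∷ L} (there y∈L) ¬py qy with p a in pa | q a in qa
  ... | true  | true  = s≤s (countTrue-mono-< p⇒q y∈L ¬py qy)
  ... | false | true  = m<n⇒m<1+n (countTrue-mono-< p⇒q y∈L ¬py qy)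
  ... | false | false = countTrue-mono-< p⇒q y∈L ¬py qy
  ... | true  | false = ⊥-elim (subst T qa (p⇒q a (subst T (sym pa) _)))

  countTrue-pos : ∀ (p : A → Bool) {L y} → y ∈ L → T (p y) → 0 < countTrue p L
  countTrue-pos p {a ∷ L} (here refl) py with p a
  ... | true = z<s
  countTrue-pos p {a ∷ L} (there y∈L) py with p a
  ... | true  = z<s
  ... | false = countTrue-pos p y∈L py

  countTrue-partition : ∀ (p q : A → Bool) L →
    countTrue (λ a → p a ∧ not (q a)) L + countTrue (λ a → p a ∧ q a) L ≡ countTrue p L
  countTrue-partition p q []      = refl
  countTrue-partition p q (a ∷ L) with p a | q a
  ... | true  | true  = trans (+-suc _ _) (cong suc (countTrue-partition p q L))
  ... | true  | false = cong suc (countTrue-partition p q L)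
  ... | false | _     = countTrue-partition p q L

  length-selectMap : ∀ (u : A → Bool) g L → length (selectMap u g L) ≡ countTrue u L
  length-selectMap u g []      = refl
  length-selectMap u g (a ∷ L) with u a
  ... | true  = cong suc (length-selectMap u g L)
  ... | false = length-selectMap u g L

  All-selectMap⁻ : ∀ {P : ℕ → Set} {u : A → Bool} {g} {L} → All P (selectMap u g L) →
    ∀ {a} → a ∈ L → T (u a) → P (g a)
  All-selectMap⁻ {u = u} {L = b ∷ L} all (here refl) ua with u b
  All-selectMap⁻ (pb ∷ _) (here refl) ua | true = pb
  All-selectMap⁻ {u = u} {L = b ∷ L} all (there a∈L) ua with u b
  All-selectMap⁻ (_ ∷ all) (there a∈L) ua | true  = All-selectMap⁻ all a∈L ua
  All-selectMap⁻ all       (there a∈L) ua | false = All-selectMap⁻ all a∈L ua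

  sum-map-mono-≤ : ∀ {f g : A → ℕ} → (∀ a → f a ≤ g a) → ∀ L → sum (map f L) ≤ sum (map g L)
  sum-map-mono-≤ f≤g []      = z≤n
  sum-map-mono-≤ f≤g (a ∷ L) = +-mono-≤ (f≤g a) (sum-map-mono-≤ f≤g L)

  sum-map-mono-< : ∀ {f g : A → ℕ} → (∀ a → f a ≤ g a) → ∀ {L y} → y ∈ L → f y < g y →
    sum (map f L) < sum (map g L)
  sum-map-mono-< f≤g {a ∷ L} (here refl) fy<gy = +-mono-<-≤ fy<gy (sum-map-mono-≤ f≤g L)
  sum-map-mono-< f≤g {a ∷ L} (there y∈L) fy<gy = +-mono-≤-< (f≤g a) (sum-map-mono-< f≤g y∈L fy<gy)

  selectMap-all : ∀ (g : A → ℕ) L → selectMap (λ _ → true) g L ≡ map g L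
  selectMap-all g []      = refl
  selectMap-all g (a ∷ L) = cong (g a ∷_) (selectMap-all g L)

countTrue-allFin-≤ : ∀ {k} (p : Fin k → Bool) → countTrue p (allFin k) ≤ k
countTrue-allFin-≤ {k} p = ≤-trans (countTrue-≤-length p (allFin k)) (≤-reflexive (length-tabulate id))

m+n<o+p∧o≤n⇒m<p : ∀ {m n o p} → m + n < o + p → o ≤ n → m < p
m+n<o+p∧o≤n⇒m<p {m} {n} {o} {p} lt o≤n =
  +-cancelʳ-< n m p (<-≤-trans lt (≤-trans (+-monoˡ-≤ p o≤n) (≤-reflexive (+-comm n p))))

m+1+n≡o⇒m<o : ∀ {m n o} → m + suc n ≡ o → m < o
m+1+n≡o⇒m<o {m} refl = m<m+n m z<s

length≡0⇒≡[] : ∀ {A : Set} {xs : List A} → length xs ≡ 0 → xs ≡ []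
length≡0⇒≡[] {xs = []} _ = refl

-- chains t gs counts the sequences t ≤ s₁ < s₂ < ⋯ with sᵢ ≤ gᵢ, one term per entry of gs;
-- headedChains k t gs counts the sequences t ≤ s₀ < s₁ < ⋯ with s₀ < t + k and sᵢ ≤ gᵢ for i ≥ 1.
mutual
  chains : ℕ → List ℕ → ℕ
  chains t []       = 1
  chains t (g ∷ gs) = headedChains (suc g ∸ t) t gs

  headedChains : ℕ → ℕ → List ℕ → ℕ
  headedChains zero    t gs = 0
  headedChains (suc k) t gs = chains (suc t) gs + headedChains k (suc t) gs

mutual
  chains-mono : ∀ t {xs ys} → Pointwise _≤_ xs ys → chains t xs ≤ chains t ys
  chains-mono t []       = ≤-refl
  chains-mono t (x≤y ∷ xs≤ys) = headedChains-mono (∸-monoˡ-≤ t (s≤s x≤y)) t xs≤ys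

  headedChains-mono : ∀ {k l} → k ≤ l → ∀ t {xs ys} → Pointwise _≤_ xs ys →
                      headedChains k t xs ≤ headedChains l t ys
  headedChains-mono {zero}          _         t _      = z≤n
  headedChains-mono {suc k} {suc l} (s≤s k≤l) t xs≤ys =
    +-mono-≤ (chains-mono (suc t) xs≤ys) (headedChains-mono k≤l (suc t) xs≤ys)

mutual
  chains-map-suc : ∀ t xs → chains (suc t) (map suc xs) ≡ chains t xs
  chains-map-suc t []       = refl
  chains-map-suc t (x ∷ xs) = headedChains-map-suc (suc x ∸ t) t xs

  headedChains-map-suc : ∀ k t xs → headedChains k (suc t) (map suc xs) ≡ headedChains k t xs
  headedChains-map-suc zero    t xs = refl
  headedChains-map-suc (suc k) t xs =
    cong₂ _+_ (chains-map-suc (suc t) xs) (headedChains-map-suc k (suc t) xs)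

≤-map-suc : ∀ xs → Pointwise _≤_ xs (map suc xs)
≤-map-suc []       = []
≤-map-suc (x ∷ xs) = n≤1+n x ∷ ≤-map-suc xs

chains-suc-≤ : ∀ t xs → chains (suc t) xs ≤ chains t xs
chains-suc-≤ t xs = ≤-trans (chains-mono (suc t) (≤-map-suc xs)) (≤-reflexive (chains-map-suc t xs))

chains-∷ : ∀ {t g} gs → t ≤ g → chains t (g ∷ gs) ≡ chains (suc t) gs + chains (suc t) (g ∷ gs)
chains-∷ gs t≤g rewrite +-∸-assoc 1 t≤g = refl

chains-∷-≤ : ∀ t g gs → chains t (g ∷ gs) ≤ chains (suc t) gs + chains (suc t) (g ∷ gs)
chains-∷-≤ t g gs with t ≤? g
... | yes t≤g = ≤-reflexive (chains-∷ gs t≤g)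
... | no  t≰g rewrite m≤n⇒m∸n≡0 (≰⇒> t≰g) = z≤n

ChainSplit : List ℕ → List ℕ → List ℕ → Set
ChainSplit xs ys zs = ∀ t → chains t xs ≤ chains t ys + chains t zs

headedChains-split : ∀ k t {xs ys zs} → ChainSplit xs ys zs →
  headedChains k t xs ≤ headedChains k t ys + headedChains k t zs
headedChains-split zero    t split = z≤n
headedChains-split (suc k) t {xs} {ys} {zs} split = begin
  chains (suc t) xs + headedChains k (suc t) xs
    ≤⟨ +-mono-≤ (split (suc t)) (headedChains-split k (suc t) split) ⟩
  (chains (suc t) ys + chains (suc t) zs) + (headedChains k (suc t) ys + headedChains k (suc t) zs)
    ≡⟨ interchange +-commutativeSemigroup (chains (suc t) ys) (chains (suc t) zs) _ _ ⟩
  (chains (suc t) ys + headedChains k (suc t) ys) + (chains (suc t) zs + headedChains k (suc t) zs) ∎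
  where open ≤-Reasoning

∷-chainSplit : ∀ g {xs ys zs} → ChainSplit xs ys zs → ChainSplit (g ∷ xs) (g ∷ ys) (g ∷ zs)
∷-chainSplit g split t = headedChains-split (suc g ∸ t) t split

-- Split by whether s₁ = t, then shift all later terms down by one.
head-chainSplit : ∀ h {xs} ys → Pointwise _≤_ xs (map suc ys) → ChainSplit (h ∷ xs) ys ((h ∸ 1) ∷ ys)
head-chainSplit h {xs} ys xs≤ys+1 t = begin
  chains t (h ∷ xs)                                   ≤⟨ chains-mono t (≤-refl ∷ xs≤ys+1) ⟩
  chains t (h ∷ map suc ys)                           ≤⟨ chains-∷-≤ t h (map suc ys) ⟩
  chains (suc t) (map suc ys) + chains (suc t) (h ∷ map suc ys)
    ≤⟨ +-monoʳ-≤ _ (chains-mono (suc t) (m≤n+m∸n h 1 ∷ Pointwise.refl ≤-refl)) ⟩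
  chains (suc t) (map suc ys) + chains (suc t) (map suc ((h ∸ 1) ∷ ys))
    ≡⟨ cong₂ _+_ (chains-map-suc t ys) (chains-map-suc t ((h ∸ 1) ∷ ys)) ⟩
  chains t ys + chains t ((h ∸ 1) ∷ ys)               ∎
  where open ≤-Reasoning

headedChains-≤ : ∀ k t gs → headedChains k t gs ≤ k * chains (suc t) gs
headedChains-≤ zero    t gs = z≤n
headedChains-≤ (suc k) t gs = +-monoʳ-≤ (chains (suc t) gs)
  (≤-trans (headedChains-≤ k (suc t) gs) (*-monoʳ-≤ k (chains-suc-≤ (suc t) gs)))

chains-pos : ∀ t xs → 0 < chains t xs → All (t ≤_) xs
chains-pos t []       _   = []
chains-pos t (g ∷ gs) pos = t≤g ∷ All.map (≤-trans (n≤1+n t)) (chains-pos (suc t) gs tail-pos)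
  where
  bound : 0 < (suc g ∸ t) * chains (suc t) gs
  bound = <-≤-trans pos (headedChains-≤ (suc g ∸ t) t gs)
  nonZero : NonZero ((suc g ∸ t) * chains (suc t) gs)
  nonZero = >-nonZero bound
  t≤g : t ≤ g
  t≤g = ≤-pred (m∸n≢0⇒n<m (≢-nonZero⁻¹ _ {{m*n≢0⇒m≢0 (suc g ∸ t) {{nonZero}}}}))
  tail-pos : 0 < chains (suc t) gs
  tail-pos = >-nonZero⁻¹ _ {{m*n≢0⇒n≢0 (suc g ∸ t) {{nonZero}}}}

module FirstMarked {A : Set} (_≟_ : DecidableEquality A) (u mk : A → Bool) (g : A → ℕ) where

  only : A → A → Bool
  only v x = ⌊ x ≟ v ⌋

  tokensAfter : (A → Bool) → List A → List ℕ
  tokensAfter I = selectMap (remaining u I) (spent mk I g)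

  tokensAfter-only-∉ : ∀ {v} L → All (v ≢_) L → tokensAfter (only v) L ≡ tokensAfter none L
  tokensAfter-only-∉     []       []           = refl
  tokensAfter-only-∉ {v} (x ∷ L) (v≢x ∷ v∉L) with x ≟ v
  ... | yes x≡v = ⊥-elim (v≢x (sym x≡v))
  ... | no  _   = cong (λ r → if u x ∧ true then spent mk none g x ∷ r else r) (tokensAfter-only-∉ L v∉L)

  ≤-tokensAfter-none : ∀ L → Pointwise _≤_ (selectMap u g L) (map suc (tokensAfter none L))
  ≤-tokensAfter-none []      = []
  ≤-tokensAfter-none (x ∷ L) with u x | mk x
  ... | false | _     = ≤-tokensAfter-none L
  ... | true  | true  = m≤n+m∸n (g x) 1 ∷ ≤-tokensAfter-none L
  ... | true  | false = n≤1+n (g x) ∷ ≤-tokensAfter-none L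

  chainSplit-head : ∀ {v} L → T (u v ∧ mk v) → All (v ≢_) L →
    ChainSplit (selectMap u g (v ∷ L)) (tokensAfter (only v) (v ∷ L)) (tokensAfter none (v ∷ L))
  chainSplit-head {v} L marked v∉L with u v | mk v | v ≟ v
  ... | true | true | yes _ rewrite tokensAfter-only-∉ L v∉L =
    head-chainSplit (g v) (tokensAfter none L) (≤-tokensAfter-none L)
  ... | _    | _    | no v≢v = ⊥-elim (v≢v refl)

  ∷-tokensAfter-none : ∀ {x} L → ¬ T (u x ∧ mk x) →
    selectMap u g L ≡ tokensAfter none L → selectMap u g (x ∷ L) ≡ tokensAfter none (x ∷ L)
  ∷-tokensAfter-none {x} L unmarked eq with u x | mk x
  ... | false | _     = eq
  ... | true  | false = cong (g x ∷_) eq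
  ... | true  | true  = ⊥-elim (unmarked _)

  ∷-chainSplit-unmarked : ∀ {x v} L → ¬ T (u x ∧ mk x) → T (u v ∧ mk v) →
    ChainSplit (selectMap u g L) (tokensAfter (only v) L) (tokensAfter none L) →
    ChainSplit (selectMap u g (x ∷ L)) (tokensAfter (only v) (x ∷ L)) (tokensAfter none (x ∷ L))
  ∷-chainSplit-unmarked {x} {v} L unmarked marked split with x ≟ v
  ... | yes refl = ⊥-elim (unmarked marked)
  ... | no _ with u x | mk x
  ...   | false | _     = split
  ...   | true  | false = ∷-chainSplit (g x) split
  ...   | true  | true  = ⊥-elim (unmarked _)

  firstMarked : ∀ L → Unique L →
    selectMap u g L ≡ tokensAfter none L ⊎
    ∃ λ v → T (u v ∧ mk v) × ChainSplit (selectMap u g L) (tokensAfter (only v) L) (tokensAfter none L)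
  firstMarked []      _             = inj₁ refl
  firstMarked (x ∷ L) (x∉L ∷ uniq) with T? (u x ∧ mk x)
  ... | yes marked = inj₂ (x , marked , chainSplit-head L marked x∉L)
  ... | no unmarked with firstMarked L uniq
  ...   | inj₁ eq                   = inj₁ (∷-tokensAfter-none L unmarked eq)
  ...   | inj₂ (v , marked , split) = inj₂ (v , marked , ∷-chainSplit-unmarked L unmarked marked split)

#paths : (ℕ → ℕ → Bool) → ℕ → ℕ → ℕ → ℕ → ℕ
#paths P i j p b = countTrue (allVerts P i j) (allPaths p b)

length-allPaths-0 : ∀ p → length (allPaths p 0) ≡ 1
length-allPaths-0 zero    = refl
length-allPaths-0 (suc p) = trans (length-map (R ∷_) (allPaths p 0)) (length-allPaths-0 p)

#paths-horizontal : ∀ P i j p → #paths P i j p 0 ≤ 1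
#paths-horizontal P i j p =
  ≤-trans (countTrue-≤-length (allVerts P i j) (allPaths p 0)) (≤-reflexive (length-allPaths-0 p))

#paths-blocked : ∀ {P i j} p b → P i j ≡ false → #paths P i j p b ≡ 0
#paths-blocked {P} {i} {j} p b blocked = countTrue-none starts-blocked (allPaths p b)
  where
  starts-blocked : ∀ s → allVerts P i j s ≡ false
  starts-blocked []      = blocked
  starts-blocked (R ∷ s) rewrite blocked = refl
  starts-blocked (U ∷ s) rewrite blocked = refl

#paths-up : ∀ {P i j} b → P i j ≡ true → #paths P i j 0 (suc b) ≡ #paths P i (suc j) 0 b
#paths-up {P} {i} {j} b ok = trans (countTrue-map (allVerts P i j) (U ∷_) (allPaths 0 b))
  (countTrue-cong (λ s → cong (_∧ allVerts P i (suc j) s) ok) (allPaths 0 b))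

#paths-right-up : ∀ {P i j} p b → P i j ≡ true →
  #paths P i j (suc p) (suc b) ≡ #paths P (suc i) j p (suc b) + #paths P i (suc j) (suc p) b
#paths-right-up {P} {i} {j} p b ok = begin
  countTrue (allVerts P i j) (map (R ∷_) rights ++ map (U ∷_) ups)
    ≡⟨ countTrue-++ (allVerts P i j) (map (R ∷_) rights) (map (U ∷_) ups) ⟩
  countTrue (allVerts P i j) (map (R ∷_) rights) + countTrue (allVerts P i j) (map (U ∷_) ups)
    ≡⟨ cong₂ _+_ (countTrue-map (allVerts P i j) (R ∷_) rights) (countTrue-map (allVerts P i j) (U ∷_) ups) ⟩
  countTrue (λ s → P i j ∧ allVerts P (suc i) j s) rights + countTrue (λ s → P i j ∧ allVerts P i (suc j) s) ups
    ≡⟨ cong₂ _+_ (countTrue-cong (λ s → cong (_∧ allVerts P (suc i) j s) ok) rights)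
                 (countTrue-cong (λ s → cong (_∧ allVerts P i (suc j) s) ok) ups) ⟩
  #paths P (suc i) j p (suc b) + #paths P i (suc j) (suc p) b ∎
  where
  open ≡-Reasoning
  rights = allPaths p (suc b)
  ups    = allPaths (suc p) b

i+s≤F : ∀ {i s F} → + i ℤ.≤ + F ℤ.- + s → i + s ≤ F
i+s≤F {i} {s} {F} i≤F-s = ℤ.drop‿+≤+ (begin
  + i ℤ.+ + s               ≤⟨ ℤ.+-monoˡ-≤ (+ s) i≤F-s ⟩
  + F ℤ.- + s ℤ.+ + s       ≡⟨ ℤ.+-assoc (+ F) (ℤ.- + s) (+ s) ⟩
  + F ℤ.+ (ℤ.- + s ℤ.+ + s) ≡⟨ cong (ℤ._+_ (+ F)) (ℤ.+-inverseˡ (+ s)) ⟩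
  + F ℤ.+ + 0               ≡⟨ ℤ.+-identityʳ (+ F) ⟩
  + F                       ∎)
  where open ℤ.≤-Reasoning

module _ {n : ℕ} (f : Fin n → ℕ) where

  -- fAt j = f(v_{j+1}); the value 0 beyond the clique is never used.
  fAt : ℕ → ℕ
  fAt j with j <? n
  ... | yes j<n = f (fromℕ< j<n)
  ... | no  _   = 0

  fWindow : ℕ → ℕ → List ℕ
  fWindow j zero    = []
  fWindow j (suc b) = fAt j ∷ fWindow (suc j) b

  dominated : ℕ → ℕ → Bool
  dominated = domOK (xvec f)

  dominated⇒< : ∀ {i j} → j < n → dominated i j ≡ true → suc (i + j) ≤ fAt j
  dominated⇒< {i} {j} j<n ok with j <? n
  ... | no  j≮n = ⊥-elim (j≮n j<n)
  ... | yes j<n′ = subst (_≤ f (fromℕ< j<n′)) index-shift (i+s≤F (toWitness (Equivalence.from T-≡ ok)))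
    where
    index-shift : i + suc (toℕ (fromℕ< j<n′)) ≡ suc (i + j)
    index-shift = trans (cong (λ k → i + suc k) (toℕ-fromℕ< j<n′)) (+-suc i j)

  chains-fWindow-∷ : ∀ {i j} b → j < n → dominated i j ≡ true →
    chains (suc (suc (i + j))) (fWindow j (suc b)) + chains (suc (i + suc j)) (fWindow (suc j) b)
      ≡ chains (suc (i + j)) (fWindow j (suc b))
  chains-fWindow-∷ {i} {j} b j<n ok = begin
    chains (suc (suc (i + j))) (fAt j ∷ W) + chains (suc (i + suc j)) W
      ≡⟨ cong (λ k → chains (suc (suc (i + j))) (fAt j ∷ W) + chains (suc k) W) (+-suc i j) ⟩
    chains (suc (suc (i + j))) (fAt j ∷ W) + chains (suc (suc (i + j))) W
      ≡⟨ +-comm (chains (suc (suc (i + j))) (fAt j ∷ W)) _ ⟩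
    chains (suc (suc (i + j))) W + chains (suc (suc (i + j))) (fAt j ∷ W)
      ≡⟨ chains-∷ W (dominated⇒< j<n ok) ⟨
    chains (suc (i + j)) (fAt j ∷ W) ∎
    where
    open ≡-Reasoning
    W = fWindow (suc j) b

  -- A dominated path from (i, j) is determined by the values i′ + j′ + 1 at its up-steps (i′, j′),
  -- and domination there says exactly i′ + j′ + 1 ≤ f(v_{j′+1}).
  #dominated-≤-chains : ∀ p b i j → j + b ≡ n → #paths dominated i j p b ≤ chains (suc (i + j)) (fWindow j b)
  #dominated-≤-chains p zero i j _ = #paths-horizontal dominated i j p
  #dominated-≤-chains p (suc b) i j j+b≡n with dominated i j in ok
  ... | false = subst (_≤ _) (sym (#paths-blocked p (suc b) ok)) z≤n
  ... | true with p
  ...   | zero = begin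
    #paths dominated i j 0 (suc b)                                    ≡⟨ #paths-up b ok ⟩
    #paths dominated i (suc j) 0 b
      ≤⟨ #dominated-≤-chains 0 b i (suc j) (trans (sym (+-suc j b)) j+b≡n) ⟩
    chains (suc (i + suc j)) (fWindow (suc j) b)                      ≤⟨ m≤n+m _ _ ⟩
    chains (suc (suc (i + j))) (fWindow j (suc b)) + chains (suc (i + suc j)) (fWindow (suc j) b)
      ≡⟨ chains-fWindow-∷ b (m+1+n≡o⇒m<o j+b≡n) ok ⟩
    chains (suc (i + j)) (fWindow j (suc b))                          ∎
    where open ≤-Reasoning
  ...   | suc p = begin
    #paths dominated i j (suc p) (suc b)                              ≡⟨ #paths-right-up p b ok ⟩
    #paths dominated (suc i) j p (suc b) + #paths dominated i (suc j) (suc p) b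
      ≤⟨ +-mono-≤ (#dominated-≤-chains p (suc b) (suc i) j j+b≡n)
                  (#dominated-≤-chains (suc p) b i (suc j) (trans (sym (+-suc j b)) j+b≡n)) ⟩
    chains (suc (suc (i + j))) (fWindow j (suc b)) + chains (suc (i + suc j)) (fWindow (suc j) b)
      ≡⟨ chains-fWindow-∷ b (m+1+n≡o⇒m<o j+b≡n) ok ⟩
    chains (suc (i + j)) (fWindow j (suc b))                          ∎
    where open ≤-Reasoning

  fAt-toℕ : ∀ r → fAt (toℕ r) ≡ f r
  fAt-toℕ r with toℕ r <? n
  ... | yes r<n = cong f (fromℕ<-toℕ r r<n)
  ... | no  r≮n = ⊥-elim (r≮n (toℕ<n r))

  fWindow-tabulate : ∀ j b → fWindow j b ≡ tabulate (λ (r : Fin b) → fAt (j + toℕ r))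
  fWindow-tabulate j zero    = refl
  fWindow-tabulate j (suc b) = cong₂ _∷_ (cong fAt (sym (+-identityʳ j)))
    (trans (fWindow-tabulate (suc j) b) (tabulate-cong (λ r → cong fAt (sym (+-suc j (toℕ r))))))

  fWindow-allFin : fWindow 0 n ≡ map f (allFin n)
  fWindow-allFin = begin
    fWindow 0 n               ≡⟨ fWindow-tabulate 0 n ⟩
    tabulate (fAt ∘ toℕ)      ≡⟨ tabulate-cong fAt-toℕ ⟩
    tabulate f                ≡⟨ map-tabulate id f ⟨
    map f (allFin n)          ∎
    where open ≡-Reasoning

ψ-≤-chains : ∀ k (f : Fin (suc k) → ℕ) → ψ (suc k) (xvec f) ≤ chains 1 (map f (allFin (suc k)))
ψ-≤-chains k f with xvec f (fromℕ k)
... | + a      = subst (λ gs → #paths (dominated f) 0 0 a (suc k) ≤ chains 1 gs) (fWindow-allFin f)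
                   (#dominated-≤-chains f a (suc k) 0 0 refl)
... | -[1+ _ ] = z≤n

module JoinStrategy (n m : ℕ) where

  V : Set
  V = JoinV n m

  vertices : List V
  vertices = map inj₁ (allFin n) ++ map inj₂ (allFin m)

  ∈-vertices : ∀ z → z ∈ vertices
  ∈-vertices (inj₁ x) = ∈-++⁺ˡ (∈-map⁺ inj₁ (∈-allFin x))
  ∈-vertices (inj₂ w) = ∈-++⁺ʳ (map inj₁ (allFin n)) (∈-map⁺ inj₂ (∈-allFin w))

  weight : (V → Bool) → (V → ℕ) → V → ℕ
  weight u h z = if u z then suc (h z) else 0

  potential : (V → Bool) → (V → ℕ) → ℕ
  potential u h = sum (map (weight u h) vertices)

  potential-decreases : ∀ {u h} M I → (∀ z → T (M z) → T (u z)) → (∀ z → T (u z) → 1 ≤ h z) →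
    ∀ {z} → T (M z) → potential (remaining u I) (spent M I h) < potential u h
  potential-decreases {u} {h} M I M⊆u tokens {z} Mz =
    sum-map-mono-< weight-≤ (∈-vertices z) (weight-< (M⊆u z Mz) Mz (tokens z (M⊆u z Mz)))
    where
    weight-≤ : ∀ y → weight (remaining u I) (spent M I h) y ≤ weight u h y
    weight-≤ y with u y | I y | M y
    ... | true  | false | true  = s≤s (m∸n≤m (h y) 1)
    ... | true  | false | false = ≤-refl
    ... | true  | true  | _     = z≤n
    ... | false | _     | _     = z≤n
    weight-< : T (u z) → T (M z) → 1 ≤ h z → weight (remaining u I) (spent M I h) z < weight u h z
    weight-< uz Mz 1≤hz with u z | I z | M z
    ... | true | true  | _    = z<s
    ... | true | false | true = s≤s (∸-monoʳ-< z<s 1≤hz)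

  cliqueLeft : (V → Bool) → ℕ
  cliqueLeft u = countTrue (u ∘ inj₁) (allFin n)

  cliqueTokens : (V → Bool) → (V → ℕ) → List ℕ
  cliqueTokens u h = selectMap (u ∘ inj₁) (h ∘ inj₁) (allFin n)

  tight : (V → Bool) → (V → ℕ) → Fin m → Bool
  tight u h w = u (inj₂ w) ∧ (h (inj₂ w) ≤ᵇ cliqueLeft u)

  #tight : (V → Bool) → (V → ℕ) → ℕ
  #tight u h = countTrue (tight u h) (allFin m)

  record Invariant (u : V → Bool) (h : V → ℕ) : Set where
    field
      few-tight     : #tight u h < chains 1 (cliqueTokens u h)
      enough-tokens : ∀ w → T (u (inj₂ w)) → cliqueLeft u ≤ h (inj₂ w)
  open Invariant

  tokens-pos : ∀ {u h} → Invariant u h → ∀ z → T (u z) → 1 ≤ h z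
  tokens-pos {u} {h} inv (inj₁ x) ux =
    All-selectMap⁻ (chains-pos 1 (cliqueTokens u h) (≤-trans (s≤s z≤n) (few-tight inv))) (∈-allFin x) ux
  tokens-pos {u} {h} inv (inj₂ w) uw with h (inj₂ w) in hw
  ... | suc _ = s≤s z≤n
  ... | zero  = ⊥-elim (<⇒≱ (countTrue-pos (tight u h) (∈-allFin w) w-tight) no-tight)
    where
    no-clique : cliqueLeft u ≡ 0
    no-clique = n≤0⇒n≡0 (subst (cliqueLeft u ≤_) hw (enough-tokens inv w uw))
    w-tight : T (tight u h w)
    w-tight rewrite hw = subst T (sym (∧-identityʳ (u (inj₂ w)))) uw
    no-clique-tokens : cliqueTokens u h ≡ []
    no-clique-tokens = length≡0⇒≡[] (trans (length-selectMap (u ∘ inj₁) (h ∘ inj₁) (allFin n)) no-clique)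
    no-tight : #tight u h ≤ 0
    no-tight = ≤-pred (subst (λ gs → #tight u h < chains 1 gs) no-clique-tokens (few-tight inv))

  colourClique : Fin n → V → Bool
  colourClique v (inj₁ x) = ⌊ x F.≟ v ⌋
  colourClique v (inj₂ _) = false

  colourIndependent : (V → Bool) → V → Bool
  colourIndependent M (inj₁ _) = false
  colourIndependent M (inj₂ w) = M (inj₂ w)

  colourClique-⊆ : ∀ (M : V → Bool) v → T (M (inj₁ v)) → ∀ z → T (colourClique v z) → T (M z)
  colourClique-⊆ M v Mv (inj₁ x) x≡v with toWitness x≡v
  ... | refl = Mv

  colourClique-independent : ∀ v a b → T (colourClique v a) → T (colourClique v b) → ¬ JoinE a b
  colourClique-independent v (inj₁ x) (inj₁ y) x≡v y≡v x≢y =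
    x≢y (trans (toWitness x≡v) (sym (toWitness y≡v)))

  colourIndependent-⊆ : ∀ M z → T (colourIndependent M z) → T (M z)
  colourIndependent-⊆ M (inj₂ w) Mw = Mw

  colourIndependent-independent : ∀ M a b → T (colourIndependent M a) → T (colourIndependent M b) → ¬ JoinE a b
  colourIndependent-independent M (inj₂ w) (inj₂ w′) _ _ ()

  #tightMarked : (V → Bool) → (V → ℕ) → (V → Bool) → ℕ
  #tightMarked u h M = countTrue (λ w → tight u h w ∧ M (inj₂ w)) (allFin m)

  #tightUnmarked : (V → Bool) → (V → ℕ) → (V → Bool) → ℕ
  #tightUnmarked u h M = countTrue (λ w → tight u h w ∧ not (M (inj₂ w))) (allFin m)

  invariant-colourClique : ∀ {u h M v} → Invariant u h → T (u (inj₁ v)) →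
    #tightMarked u h M < chains 1 (cliqueTokens (remaining u (colourClique v)) (spent M (colourClique v) h)) →
    Invariant (remaining u (colourClique v)) (spent M (colourClique v) h)
  invariant-colourClique {u} {h} {M} {v} inv uv fits = record
    { few-tight     = ≤-<-trans (countTrue-mono (λ w → still-tight w (enough-tokens inv w)) (allFin m)) fits
    ; enough-tokens = λ w → still-enough w (enough-tokens inv w)
    }
    where
    u′ = remaining u (colourClique v)
    h′ = spent M (colourClique v) h

    r′<r : cliqueLeft u′ < cliqueLeft u
    r′<r = countTrue-mono-< (λ x → proj₁ ∘ Equivalence.to T-∧) (∈-allFin v) v-coloured uv
      where
      v-coloured : ¬ T (u (inj₁ v) ∧ not ⌊ v F.≟ v ⌋)
      v-coloured with v F.≟ v
      ... | yes _  = proj₂ ∘ Equivalence.to T-∧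
      ... | no v≢v = ⊥-elim (v≢v refl)

    still-tight : ∀ w → (T (u (inj₂ w)) → cliqueLeft u ≤ h (inj₂ w)) →
      T (tight u′ h′ w) → T (tight u h w ∧ M (inj₂ w))
    still-tight w enough tight′ with u (inj₂ w) | M (inj₂ w)
    ... | true | true  = Equivalence.from T-∧ (≤⇒≤ᵇ hw≤r , _)
      where
      hw≤r : h (inj₂ w) ≤ cliqueLeft u
      hw≤r = ≤-trans (m≤n+m∸n (h (inj₂ w)) 1) (≤-trans (s≤s (≤ᵇ⇒≤ _ _ tight′)) r′<r)
    ... | true | false = ⊥-elim (<⇒≱ (≤-<-trans (≤ᵇ⇒≤ _ _ tight′) r′<r) (enough _))

    still-enough : ∀ w → (T (u (inj₂ w)) → cliqueLeft u ≤ h (inj₂ w)) →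
      T (u′ (inj₂ w)) → cliqueLeft u′ ≤ h′ (inj₂ w)
    still-enough w enough _ with u (inj₂ w) | M (inj₂ w)
    ... | true | true  = ∸-monoˡ-≤ 1 (≤-trans r′<r (enough _))
    ... | true | false = ≤-trans (<⇒≤ r′<r) (enough _)

  invariant-colourIndependent : ∀ {u h M} → Invariant u h →
    #tightUnmarked u h M < chains 1 (cliqueTokens (remaining u (colourIndependent M)) (spent M (colourIndependent M) h)) →
    Invariant (remaining u (colourIndependent M)) (spent M (colourIndependent M) h)
  invariant-colourIndependent {u} {h} {M} inv fits = record
    { few-tight     = subst (_< chains 1 (cliqueTokens u′ h′)) (sym (countTrue-cong tight′ (allFin m))) fits
    ; enough-tokens = still-enough
    }
    where
    u′ = remaining u (colourIndependent M)
    h′ = spent M (colourIndependent M) h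

    r′≡r : cliqueLeft u′ ≡ cliqueLeft u
    r′≡r = countTrue-cong (λ x → ∧-identityʳ (u (inj₁ x))) (allFin n)

    tight′ : ∀ w → tight u′ h′ w ≡ (tight u h w ∧ not (M (inj₂ w)))
    tight′ w rewrite r′≡r with u (inj₂ w) | M (inj₂ w)
    ... | true  | true  = sym (∧-zeroʳ _)
    ... | true  | false = sym (∧-identityʳ _)
    ... | false | _     = refl

    still-enough : ∀ w → T (u′ (inj₂ w)) → cliqueLeft u′ ≤ h′ (inj₂ w)
    still-enough w uw′ rewrite r′≡r with u (inj₂ w) in uw | M (inj₂ w)
    ... | true | false = enough-tokens inv w (subst T (sym uw) _)

  Move : (V → Bool) → (V → ℕ) → (V → Bool) → Set
  Move u h M = Σ (V → Bool) λ I →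
    (∀ z → T (I z) → T (M z)) × (∀ a b → T (I a) → T (I b) → ¬ JoinE a b) ×
    Paintable JoinE (remaining u I) (spent M I h)

  painterWins : ∀ u h → Acc _<_ (potential u h) → Invariant u h → Paintable JoinE u h
  painterWins u h (acc smaller) inv = step (tokens-pos inv) respond
    where
    respond : ∀ M → (∀ z → T (M z) → T (u z)) → ∃ (λ z → T (M z)) → Move u h M
    respond M M⊆u (z , Mz) =
      [ whenNoneMarked , (λ (v , marked , split) → whenFirstMarked v marked split) ]′
        (firstMarked (allFin n) (allFin⁺ n))
      where
      open FirstMarked F._≟_ (u ∘ inj₁) (M ∘ inj₁) (h ∘ inj₁)

      colour : (I : V → Bool) → (∀ z → T (I z) → T (M z)) → (∀ a b → T (I a) → T (I b) → ¬ JoinE a b) →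
               Invariant (remaining u I) (spent M I h) → Move u h M
      colour I I⊆M independent inv′ =
        I , I⊆M , independent , painterWins _ _ (smaller (potential-decreases M I M⊆u (tokens-pos inv) Mz)) inv′

      colourIndependentVertices : #tightUnmarked u h M < chains 1 (tokensAfter none (allFin n)) → Move u h M
      colourIndependentVertices fits = colour (colourIndependent M) (colourIndependent-⊆ M)
        (colourIndependent-independent M) (invariant-colourIndependent inv fits)

      whenNoneMarked : cliqueTokens u h ≡ tokensAfter none (allFin n) → Move u h M
      whenNoneMarked unchanged = colourIndependentVertices (≤-<-trans
        (countTrue-mono (λ w → proj₁ ∘ Equivalence.to T-∧) (allFin m))
        (subst (λ gs → #tight u h < chains 1 gs) unchanged (few-tight inv)))

      whenFirstMarked : ∀ v → T (u (inj₁ v) ∧ M (inj₁ v)) →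
        ChainSplit (cliqueTokens u h) (tokensAfter (only v) (allFin n)) (tokensAfter none (allFin n)) → Move u h M
      whenFirstMarked v marked split with #tightMarked u h M <? chains 1 (tokensAfter (only v) (allFin n))
      ... | yes fits = colour (colourClique v) (colourClique-⊆ M v (proj₂ uv∧Mv))
        (colourClique-independent v) (invariant-colourClique inv (proj₁ uv∧Mv) fits)
        where uv∧Mv = Equivalence.to T-∧ marked
      ... | no ¬fits = colourIndependentVertices (m+n<o+p∧o≤n⇒m<p (begin-strict
        #tightUnmarked u h M + #tightMarked u h M    ≡⟨ countTrue-partition (tight u h) (M ∘ inj₂) (allFin m) ⟩
        #tight u h                                   <⟨ few-tight inv ⟩
        chains 1 (cliqueTokens u h)                  ≤⟨ split 1 ⟩
        chains 1 (tokensAfter (only v) (allFin n)) + chains 1 (tokensAfter none (allFin n)) ∎)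
        (≮⇒≥ ¬fits))
        where open ≤-Reasoning

lemma10 : (n m : ℕ) → .{{_ : NonZero n}} → (f : Fin n → ℕ) →
    (∀ i → 1 ≤ f i) →
    (∀ i j → i F.≤ j → f i ≤ f j) →
    m < ψ n (xvec f) →
    IsPaintable (JoinE {n} {m}) (ext {n} {m} f)
lemma10 (suc k) m f _ _ m<ψ = painterWins (λ _ → true) (ext f) (<-wellFounded _) record
  { few-tight     = begin-strict
      #tight (λ _ → true) (ext f)            ≤⟨ countTrue-allFin-≤ _ ⟩
      m                                      <⟨ m<ψ ⟩
      ψ (suc k) (xvec f)                     ≤⟨ ψ-≤-chains k f ⟩
      chains 1 (map f (allFin (suc k)))      ≡⟨ cong (chains 1) (selectMap-all f (allFin (suc k))) ⟨
      chains 1 (cliqueTokens (λ _ → true) (ext f)) ∎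
  ; enough-tokens = λ _ _ → countTrue-allFin-≤ (λ _ → true)
  }
  where
  open JoinStrategy (suc k) m
  open ≤-Reasoning
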